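{- Let $M$ be a model of $\mathcal{T}_N$, let $n\geq1$, and let $A\subseteq M^n$ be an infinite simple set whose dimension as a closed subset of $\mathrm{Top}_n$ is $d$. Then $A$ is in definable bijection with $M^d$. Consequently, the number of equivalence classes of $A$ equals its dimension as a closed subset of $\mathrm{Top}_n$.
   Context: Fix a positive integer $N$. $\mathcal{T}_N$ is the theory in the language $\{f,c_1,\dots,c_N\}$ ($f$ unary, $c_i$ constants) stating: the $c_i$ are pairwise distinct; $f$ is a bijection from $M$ onto $M\setminus\{c_1,\dots,c_N\}$; and $f^n(x)\neq x$ for all $x$ and all $n\geq1$ ($f^n$ the $n$-th iterate, $f^0$ the identity). Definable means definable with parameters. A subset $A\subseteq M^n$ is simple if it is definable by a finite conjunction of formulas $x_i=f^k(x_j)$ ($k\in\mathbb{N}$) and $x_i=c$ ($c\in M$). For a simple $A$, let $C$ be the set of indices $i$ such that $x_i$ is constant on $A$; on the remaining indices, $i\sim j$ iff for some $k\in\mathbb{N}$, $x_i=f^k(x_j)$ on all of $A$ or $x_j=f^k(x_i)$ on all of $A$; the classes are the equivalence classes of $A$. $\mathrm{Top}_n$ is the topology on $M^n$ whose closed sets are generated by the simple subsets of $M^n$. The dimension of a nonempty closed set $X$ is the supremum of $n$ such that there is a chain $\varnothing\subsetneq Z_0\subsetneq\dots\subsetneq Z_n\subseteq X$ of irreducible closed sets. -}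

module Defs where

open import Level using (Level; 0ℓ) renaming (suc to lsuc)
open import Data.Nat using (ℕ; zero; suc; _+_; _≤_)
open import Data.Fin using (Fin) renaming (zero to fzero; suc to fsuc)
open import Data.List using (List)
open import Data.List.Relation.Unary.All using (All)
open import Data.List.Relation.Unary.Any using (Any)
open import Data.Product using (Σ; ∃; _×_; _,_)
open import Data.Sum using (_⊎_)
open import Data.Empty using (⊥)
open import Data.Unit using (⊤)
open import Relation.Nullary using (¬_)
open import Relation.Binary.PropositionalEquality using (_≡_; _≢_)
open import Data.Vec.Functional using (Vector; _++_)
open import Function using (_∘_)

iter : {A : Set} → (A → A) → ℕ → A → A
iter f zero    x = x
iter f (suc k) x = f (iter f k x)

record Structure (N : ℕ) : Set₁ where
  field
    Carrier : Set
    f       : Carrier → Carrier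
    c       : Fin N → Carrier

record IsModelTN {N : ℕ} (S : Structure N) : Set where
  open Structure S
  field
    c-distinct : ∀ i j → c i ≡ c j → i ≡ j
    f-injective : ∀ x y → f x ≡ f y → x ≡ y
    f-image : ∀ y → (Σ Carrier (λ x → f x ≡ y)) → ∀ i → y ≢ c i
    f-onto  : ∀ y → (∀ i → y ≢ c i) → Σ Carrier (λ x → f x ≡ y)
    acyclic : ∀ (x : Carrier) (n : ℕ) → iter f (suc n) x ≢ x

module _ {N : ℕ} (S : Structure N) where
  open Structure S

  data Term (k : ℕ) : Set where
    var : Fin k → Term k
    con : Fin N → Term k
    par : Carrier → Term k
    app : Term k → Term k

  data Formula (k : ℕ) : Set where
    _≐_   : Term k → Term k → Formula k
    ⊥ᶠ    : Formula k
    _∧ᶠ_  : Formula k → Formula k → Formula k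
    _∨ᶠ_  : Formula k → Formula k → Formula k
    _⇒ᶠ_  : Formula k → Formula k → Formula k
    ¬ᶠ_   : Formula k → Formula k
    ∀ᶠ    : Formula (suc k) → Formula k   -- binds variable fzero
    ∃ᶠ    : Formula (suc k) → Formula k   -- binds variable fzero

  evalT : ∀ {k} → Vector Carrier k → Term k → Carrier
  evalT ρ (var i) = ρ i
  evalT ρ (con i) = c i
  evalT ρ (par a) = a
  evalT ρ (app t) = f (evalT ρ t)

  extend : ∀ {k} → Carrier → Vector Carrier k → Vector Carrier (suc k)
  extend a ρ fzero    = a
  extend a ρ (fsuc i) = ρ i

  Sat : ∀ {k} → Vector Carrier k → Formula k → Set
  Sat ρ (s ≐ t)  = evalT ρ s ≡ evalT ρ t
  Sat ρ ⊥ᶠ       = ⊥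
  Sat ρ (φ ∧ᶠ ψ) = Sat ρ φ × Sat ρ ψ
  Sat ρ (φ ∨ᶠ ψ) = Sat ρ φ ⊎ Sat ρ ψ
  Sat ρ (φ ⇒ᶠ ψ) = Sat ρ φ → Sat ρ ψ
  Sat ρ (¬ᶠ φ)   = ¬ Sat ρ φ
  Sat ρ (∀ᶠ φ)   = ∀ a → Sat (extend a ρ) φ
  Sat ρ (∃ᶠ φ)   = Σ Carrier (λ a → Sat (extend a ρ) φ)

  Subset : ℕ → Set₁
  Subset k = Vector Carrier k → Set

  _≈ₚ_ : ∀ {k} → Vector Carrier k → Vector Carrier k → Set
  x ≈ₚ y = ∀ i → x i ≡ y i

  Definable : ∀ {k} → Subset k → Set
  Definable {k} X = Σ (Formula k) λ φ → ∀ x → (X x → Sat x φ) × (Sat x φ → X x)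

  data Atom (n : ℕ) : Set where
    eqf : Fin n → Fin n → ℕ → Atom n
    eqc : Fin n → Carrier → Atom n

  holds : ∀ {n} → Vector Carrier n → Atom n → Set
  holds x (eqf i j m) = x i ≡ iter f m (x j)
  holds x (eqc i a)   = x i ≡ a

  ⟦_⟧ˢ : ∀ {n} → List (Atom n) → Subset n
  ⟦ as ⟧ˢ x = All (holds x) as

  IsSimple : ∀ {n} → Subset n → Set
  IsSimple {n} X = Σ (List (Atom n)) λ as → ∀ x → (X x → ⟦ as ⟧ˢ x) × (⟦ as ⟧ˢ x → X x)

  Infinite : ∀ {n} → Subset n → Set
  Infinite {n} A = ¬ (Σ (List (Vector Carrier n)) λ l → ∀ x → A x → Any (λ y → y ≈ₚ x) l)

  -- The topology Top_n: closed sets are arbitrary intersections of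
  -- finite unions of simple sets.

  _⊆_ : ∀ {n} → Subset n → Subset n → Set
  X ⊆ Y = ∀ x → X x → Y x

  ⟦_⟧ᵇ : ∀ {n} → List (List (Atom n)) → Subset n
  ⟦ bs ⟧ᵇ x = Any (λ as → ⟦ as ⟧ˢ x) bs

  IsClosed : ∀ {n} → Subset n → Set₁
  IsClosed {n} X = Σ Set λ I → Σ (I → List (List (Atom n))) λ F →
                     ∀ x → (X x → ∀ i → ⟦ F i ⟧ᵇ x) × ((∀ i → ⟦ F i ⟧ᵇ x) → X x)

  IsIrreducible : ∀ {n} → Subset n → Set₁
  IsIrreducible {n} X =
    IsClosed X × Σ (Vector Carrier n) X ×
    (∀ (Y Z : Subset n) → IsClosed Y → IsClosed Z →
       X ⊆ (λ x → Y x ⊎ Z x) → X ⊆ Y ⊎ X ⊆ Z)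

  _⊊_ : ∀ {n} → Subset n → Subset n → Set
  X ⊊ Y = X ⊆ Y × ¬ (Y ⊆ X)

  -- a chain ∅ ⊊ Z_0 ⊊ … ⊊ Z_m ⊆ X of irreducible closed sets (length m)
  HasChain : ∀ {n} → Subset n → ℕ → Set₁
  HasChain {n} X m =
    Σ (Fin (suc m) → Subset n) λ Z →
      (∀ i → IsIrreducible (Z i)) ×
      (∀ (i : Fin m) → Z (Data.Fin.inject₁ i) ⊊ Z (fsuc i)) ×
      (Z (Data.Fin.fromℕ m) ⊆ X)

  HasDimension : ∀ {n} → Subset n → ℕ → Set₁
  HasDimension X d = HasChain X d × (∀ m → HasChain X m → m ≤ d)

  ConstantOn : ∀ {n} → Subset n → Fin n → Set
  ConstantOn A i = Σ Carrier λ a → ∀ x → A x → x i ≡ a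

  Related : ∀ {n} → Subset n → Fin n → Fin n → Set
  Related A i j =
    Σ ℕ λ m → (∀ x → A x → x i ≡ iter f m (x j)) ⊎ (∀ x → A x → x j ≡ iter f m (x i))

  -- the set of classes of ~ on the non-constant indices has exactly k
  -- elements: there are k pairwise inequivalent non-constant
  -- representatives such that every non-constant index is equivalent to
  -- one of them
  NumClasses : ∀ {n} → Subset n → ℕ → Set
  NumClasses {n} A k =
    Σ (Fin k → Fin n) λ r →
      (∀ j → ¬ ConstantOn A (r j)) ×
      (∀ j j' → Related A (r j) (r j') → j ≡ j') ×
      (∀ i → ¬ ConstantOn A i → Σ (Fin k) λ j → Related A i (r j))

  -- A ⊆ M^n is in definable bijection with M^d: there is a definable
  -- G ⊆ M^(n+d) which is the graph of a bijection A → M^d.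

  DefinableBijection : ∀ {n} → Subset n → (d : ℕ) → Set₁
  DefinableBijection {n} A d =
    Σ (Subset (n + d)) λ G →
      Definable G ×
      (∀ x y → G (x ++ y) → A x) ×
      (∀ x → A x → Σ (Vector Carrier d) λ y → G (x ++ y) × (∀ y' → G (x ++ y') → y' ≈ₚ y)) ×
      (∀ y → Σ (Vector Carrier n) λ x → A x × G (x ++ y) ×
               (∀ x' → A x' → G (x' ++ y) → x' ≈ₚ x))

{-# OPTIONS --safe #-}
-- Call a coordinate j of a set X ⊆ Mⁿ a leader if it is not constant on X, every coordinate
-- of its class is an f-iterate of it on X, and no smaller coordinate has this property.
-- On a nonempty X the leaders represent the classes, and enlarging X can only add leaders.
-- If Z ⊊ Z′ are irreducible closed sets with the same leaders, every atom valid on Z stays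
-- valid on Z′; since an irreducible closed set is cut out by the atoms valid on it, Z′ ⊆ Z.
-- So leaders strictly increase along a chain, and every chain in A has length at most the
-- number k of classes of A. Conversely, A is parametrised by its leader coordinates: every
-- coordinate is a constant or an iterate of a leader, which gives the definable bijection
-- with Mᵏ. Fixing the last k − t leader coordinates to a point c₀ yields k + 1 nested strata;
-- each is irreducible because its points with free leader coordinates p set to f^((p+1)K)(c₀)
-- are generic: an atom not valid on the stratum fails at them for all large K, since orbits
-- travelling at different speeds meet at most once.
module Submission where

open import Defs hiding (_⊆_)
import Level
open import Level using (0ℓ)
open import Axiom.ExcludedMiddle using (ExcludedMiddle)
open import Data.Nat as ℕ using (ℕ; zero; suc; _+_; _*_; _≤_; _≥_; z≤n)
import Data.Nat.Properties as ℕ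
import Data.Nat.Induction as ℕ
open import Data.Fin as Fin using (Fin; toℕ; inject₁; fromℕ; _↑ˡ_; _↑ʳ_)
  renaming (zero to fzero; suc to fsuc)
import Data.Fin.Properties as Fin
import Data.Fin.Induction as Fin
open import Data.Product using (Σ; ∃; _×_; _,_; proj₁; proj₂)
open import Data.Sum using (_⊎_; inj₁; inj₂; [_,_])
open import Data.Empty using (⊥-elim)
open import Data.Unit using (⊤; tt)
open import Data.List as List using (List; []; _∷_)
import Data.List.Relation.Unary.All as All
open import Data.List.Relation.Unary.All using ([]; _∷_)
open import Data.List.Relation.Unary.All.Properties using (¬All⇒Any¬)
import Data.List.Relation.Unary.All.Properties as Allₚ
import Data.List.Relation.Unary.Any.Properties as Anyₚ
import Data.List.Relation.Unary.Any as Any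
open import Data.List.Relation.Unary.Any using (Any; here; there)
open import Function using (_∘_)
open import Data.Vec.Functional using (Vector; _++_)
open import Data.Vec.Functional.Properties using (lookup-++ˡ; lookup-++ʳ)
open import Induction.WellFounded using (WellFounded; Acc; acc; module Subrelation)
import Relation.Binary.Construct.On as On
open import Relation.Nullary using (¬_; Dec; yes; no; contradiction)
open import Relation.Binary.PropositionalEquality hiding ([_])
open import Relation.Binary using (tri<; tri≈; tri>)

record Enumeration {n : ℕ} (P : Fin n → Set) : Set where
  field
    size      : ℕ
    enum      : Fin size → Fin n
    sound     : ∀ p → P (enum p)
    injective : ∀ {p q} → enum p ≡ enum q → p ≡ q
    complete  : ∀ {i} → P i → ∃ λ p → enum p ≡ i

module _ {n : ℕ} {P : Fin (suc n) → Set} (E : Enumeration (P ∘ fsuc)) where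
  open Enumeration E

  enumeration-cons : P fzero → Enumeration P
  enumeration-cons P0 = record
    { size = suc size ; enum = enum′ ; sound = sound′ ; injective = injective′ ; complete = complete′ }
    where
    enum′ : Fin (suc size) → Fin (suc n)
    enum′ fzero    = fzero
    enum′ (fsuc p) = fsuc (enum p)
    sound′ : ∀ p → P (enum′ p)
    sound′ fzero    = P0
    sound′ (fsuc p) = sound p
    injective′ : ∀ {p q} → enum′ p ≡ enum′ q → p ≡ q
    injective′ {fzero}  {fzero}  _ = refl
    injective′ {fsuc p} {fsuc q} e = cong fsuc (injective (Fin.suc-injective e))
    complete′ : ∀ {i} → P i → ∃ λ p → enum′ p ≡ i
    complete′ {fzero}  _  = fzero , refl
    complete′ {fsuc i} Pi = let p , e = complete Pi in fsuc p , cong fsuc e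

  enumeration-skip : ¬ P fzero → Enumeration P
  enumeration-skip ¬P0 = record
    { size = size ; enum = fsuc ∘ enum ; sound = sound
    ; injective = injective ∘ Fin.suc-injective ; complete = complete′ }
    where
    complete′ : ∀ {i} → P i → ∃ λ p → fsuc (enum p) ≡ i
    complete′ {fzero}  P0 = contradiction P0 ¬P0
    complete′ {fsuc i} Pi = let p , e = complete Pi in p , cong fsuc e

enumerate : ∀ {n} {P : Fin n → Set} → (∀ i → Dec (P i)) → Enumeration P
enumerate {zero} P? = record
  { size = 0 ; enum = λ () ; sound = λ () ; injective = λ {} ; complete = λ {} }
enumerate {suc n} P? with P? fzero
... | yes P0 = enumeration-cons (enumerate (P? ∘ fsuc)) P0
... | no ¬P0 = enumeration-skip (enumerate (P? ∘ fsuc)) ¬P0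

module _ {n : ℕ} {P Q : Fin n → Set} (E : Enumeration P) (F : Enumeration Q)
         (P⊆Q : ∀ {i} → P i → Q i) where
  private
    module E = Enumeration E
    module F = Enumeration F

    index : ∀ {i} → Q i → Fin F.size
    index Qi = proj₁ (F.complete Qi)

    index-injective : ∀ {i j} (Qi : Q i) (Qj : Q j) → index Qi ≡ index Qj → i ≡ j
    index-injective Qi Qj e =
      trans (sym (proj₂ (F.complete Qi))) (trans (cong F.enum e) (proj₂ (F.complete Qj)))

  size-mono : E.size ≤ F.size
  size-mono = Fin.injective⇒≤ {f = λ p → index (P⊆Q (E.sound p))} λ e → E.injective (index-injective _ _ e)

  size-strict : ∀ {i} → Q i → ¬ P i → E.size ℕ.< F.size
  size-strict {i} Qi ¬Pi = Fin.injective⇒≤ {f = embed} embed-injective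
    where
    embed : Fin (suc E.size) → Fin F.size
    embed fzero    = index Qi
    embed (fsuc p) = index (P⊆Q (E.sound p))
    embed-injective : ∀ {p q} → embed p ≡ embed q → p ≡ q
    embed-injective {fzero}  {fzero}  _ = refl
    embed-injective {fzero}  {fsuc q} e = contradiction (subst P (sym (index-injective _ _ e)) (E.sound q)) ¬Pi
    embed-injective {fsuc p} {fzero}  e = contradiction (subst P (index-injective _ _ e) (E.sound p)) ¬Pi
    embed-injective {fsuc p} {fsuc q} e = cong fsuc (E.injective (index-injective _ _ e))

increasing⇒length≤last : ∀ m (μ : Fin (suc m) → ℕ) → (∀ i → μ (inject₁ i) ℕ.< μ (fsuc i)) →
                         m ≤ μ (fromℕ m)
increasing⇒length≤last zero    μ increasing = z≤n
increasing⇒length≤last (suc m) μ increasing =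
  ℕ.≤-<-trans (increasing⇒length≤last m (μ ∘ inject₁) (increasing ∘ inject₁)) (increasing (fromℕ m))

Eventually : (ℕ → Set) → Set
Eventually P = ∃ λ N → ∀ K → N ≤ K → P K

eventually-map : ∀ {P Q : ℕ → Set} → (∀ {K} → P K → Q K) → Eventually P → Eventually Q
eventually-map P⇒Q (N , P-from-N) = N , λ K N≤K → P⇒Q (P-from-N K N≤K)

eventually-× : ∀ {P Q : ℕ → Set} → Eventually P → Eventually Q → Eventually (λ K → P K × Q K)
eventually-× (M , P-from-M) (N , Q-from-N) = M ℕ.⊔ N , λ K M⊔N≤K →
  P-from-M K (ℕ.≤-trans (ℕ.m≤m⊔n M N) M⊔N≤K) , Q-from-N K (ℕ.≤-trans (ℕ.m≤n⊔m M N) M⊔N≤K)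

module Classical (em : ExcludedMiddle 0ℓ) where

  enumeration : ∀ {n} (P : Fin n → Set) → Enumeration P
  enumeration P = enumerate λ _ → em

  count : ∀ {n} → (Fin n → Set) → ℕ
  count P = Enumeration.size (enumeration P)

  count-mono : ∀ {n} {P Q : Fin n → Set} → (∀ {i} → P i → Q i) → count P ≤ count Q
  count-mono = size-mono (enumeration _) (enumeration _)

  count-strict : ∀ {n} {P Q : Fin n → Set} → (∀ {i} → P i → Q i) →
                 ∀ {i} → Q i → ¬ P i → count P ℕ.< count Q
  count-strict = size-strict (enumeration _) (enumeration _)

  double-negation : {P : Set} → ¬ ¬ P → P
  double-negation {P} ¬¬P with em {P}
  ... | yes P = P
  ... | no ¬P = contradiction ¬P ¬¬P

  at-most-once⇒eventually-not : {P : ℕ → Set} → (∀ {K K′} → P K → P K′ → K ≡ K′) → Eventually (¬_ ∘ P)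
  at-most-once⇒eventually-not {P} once with em {∃ P}
  ... | yes (K , P-K) = suc K , λ K′ K<K′ P-K′ → ℕ.<-irrefl (once P-K P-K′) K<K′
  ... | no ∄K = 0 , λ K _ P-K → ∄K (K , P-K)

  minimal : {A : Set} {_⊏_ : A → A → Set} → WellFounded _⊏_ →
            (P : A → Set) → ∀ {i} → P i → ∃ λ j → P j × (∀ {k} → k ⊏ j → ¬ P k)
  minimal {A} {_⊏_} wf P {i} = descend (wf i)
    where
    descend : ∀ {j} → Acc _⊏_ j → P j → ∃ λ j → P j × (∀ {k} → k ⊏ j → ¬ P k)
    descend {j} (acc rs) Pj with em {∃ λ k → k ⊏ j × P k}
    ... | yes (k , k⊏j , Pk) = descend (rs k⊏j) Pk
    ... | no ∄k = j , Pj , λ k⊏j Pk → ∄k (_ , k⊏j , Pk)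

module Iterates {N : ℕ} (S : Structure N) (model : IsModelTN S) where
  open Structure S
  open IsModelTN model

  iter-+ : ∀ a b x → iter f (a + b) x ≡ iter f a (iter f b x)
  iter-+ zero    b x = refl
  iter-+ (suc a) b x = cong f (iter-+ a b x)

  iter-injective : ∀ m {x y} → iter f m x ≡ iter f m y → x ≡ y
  iter-injective zero    e = e
  iter-injective (suc m) e = iter-injective m (f-injective _ _ e)

  iter-exponent-injective : ∀ a b x → iter f a x ≡ iter f b x → a ≡ b
  iter-exponent-injective zero    zero    x e = refl
  iter-exponent-injective zero    (suc b) x e = contradiction (sym e) (acyclic x b)
  iter-exponent-injective (suc a) zero    x e = contradiction e (acyclic x a)
  iter-exponent-injective (suc a) (suc b) x e =
    cong suc (iter-exponent-injective a b x (f-injective _ _ e))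

  iter-split : ∀ {a b} → a ≤ b → ∃ λ d → ∀ x → iter f b x ≡ iter f a (iter f d x)
  iter-split {a} a≤b with ℕ.m≤n⇒∃[o]m+o≡n a≤b
  ... | d , refl = d , iter-+ a d

  iter-round-trip : ∀ {u v a b} → u ≡ iter f a v → v ≡ iter f b u → a + b ≡ 0
  iter-round-trip {u} {v} {a} {b} u≡ v≡ = sym (iter-exponent-injective 0 (a + b) u
    (trans u≡ (trans (cong (iter f a) v≡) (sym (iter-+ a b u)))))

  iter-comm : ∀ a b x → iter f a (iter f b x) ≡ iter f b (iter f a x)
  iter-comm a b x = begin
    iter f a (iter f b x)  ≡⟨ iter-+ a b x ⟨
    iter f (a + b) x       ≡⟨ cong (λ e → iter f e x) (ℕ.+-comm a b) ⟩
    iter f (b + a) x       ≡⟨ iter-+ b a x ⟩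
    iter f b (iter f a x)  ∎
    where open ≡-Reasoning

  private
    shift : ∀ α s K d x → iter f α (iter f (s * (K + d)) x) ≡ iter f (s * d) (iter f α (iter f (s * K) x))
    shift α s K d x = begin
      iter f α (iter f (s * (K + d)) x)            ≡⟨ cong (λ e → iter f α (iter f e x)) exponent ⟩
      iter f α (iter f (s * d + s * K) x)          ≡⟨ cong (iter f α) (iter-+ (s * d) (s * K) x) ⟩
      iter f α (iter f (s * d) (iter f (s * K) x)) ≡⟨ iter-comm α (s * d) _ ⟩
      iter f (s * d) (iter f α (iter f (s * K) x)) ∎
      where
      open ≡-Reasoning
      exponent : s * (K + d) ≡ s * d + s * K
      exponent = trans (ℕ.*-distribˡ-+ s K d) (ℕ.+-comm (s * K) (s * d))

    meet-once-≤ : ∀ {s s′} α α′ b b′ → s ≢ s′ → ∀ {K K′} → K ≤ K′ →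
      iter f α (iter f (s * K) b) ≡ iter f α′ (iter f (s′ * K) b′) →
      iter f α (iter f (s * K′) b) ≡ iter f α′ (iter f (s′ * K′) b′) → K ≡ K′
    meet-once-≤ {s} {s′} α α′ b b′ s≢s′ {K} K≤K′ eq eq′ with ℕ.m≤n⇒∃[o]m+o≡n K≤K′
    ... | zero  , refl = sym (ℕ.+-identityʳ K)
    ... | suc d , refl =
      contradiction (ℕ.*-cancelʳ-≡ s s′ (suc d) (iter-exponent-injective _ _ _ same-point)) s≢s′
      where
      open ≡-Reasoning
      x = iter f α (iter f (s * K) b)
      same-point : iter f (s * suc d) x ≡ iter f (s′ * suc d) x
      same-point = begin
        iter f (s * suc d) x                              ≡⟨ shift α s K (suc d) b ⟨
        iter f α (iter f (s * (K + suc d)) b)             ≡⟨ eq′ ⟩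
        iter f α′ (iter f (s′ * (K + suc d)) b′)          ≡⟨ shift α′ s′ K (suc d) b′ ⟩
        iter f (s′ * suc d) (iter f α′ (iter f (s′ * K) b′)) ≡⟨ cong (iter f (s′ * suc d)) eq ⟨
        iter f (s′ * suc d) x                             ∎

  orbits-meet-once : ∀ {s s′} α α′ b b′ → s ≢ s′ → ∀ {K K′} →
    iter f α (iter f (s * K) b) ≡ iter f α′ (iter f (s′ * K) b′) →
    iter f α (iter f (s * K′) b) ≡ iter f α′ (iter f (s′ * K′) b′) → K ≡ K′
  orbits-meet-once α α′ b b′ s≢s′ {K} {K′} eq eq′ with ℕ.≤-total K K′
  ... | inj₁ K≤K′ = meet-once-≤ α α′ b b′ s≢s′ K≤K′ eq eq′
  ... | inj₂ K′≤K = sym (meet-once-≤ α α′ b b′ s≢s′ K′≤K eq′ eq)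

module Formulas {N : ℕ} (S : Structure N) where
  open Structure S

  iterTerm : ∀ {m} → ℕ → Term S m → Term S m
  iterTerm zero    t = t
  iterTerm (suc j) t = app (iterTerm j t)

  evalT-iterTerm : ∀ {m} (w : Vector Carrier m) j t → evalT S w (iterTerm j t) ≡ iter f j (evalT S w t)
  evalT-iterTerm w zero    t = refl
  evalT-iterTerm w (suc j) t = cong f (evalT-iterTerm w j t)

  atomFormula : ∀ {n m} → (Fin n → Fin m) → Atom S n → Formula S m
  atomFormula ι (eqf i j k) = var (ι i) ≐ iterTerm k (var (ι j))
  atomFormula ι (eqc i a)   = var (ι i) ≐ par a

  module _ {n m} {ι : Fin n → Fin m} {w : Vector Carrier m} where

    Sat-atom⁺ : ∀ α → holds S (w ∘ ι) α → Sat S w (atomFormula ι α)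
    Sat-atom⁺ (eqf i j k) wi≡ = trans wi≡ (sym (evalT-iterTerm w k _))
    Sat-atom⁺ (eqc i a)   wi≡ = wi≡

    Sat-atom⁻ : ∀ α → Sat S w (atomFormula ι α) → holds S (w ∘ ι) α
    Sat-atom⁻ (eqf i j k) wi≡ = trans wi≡ (evalT-iterTerm w k _)
    Sat-atom⁻ (eqc i a)   wi≡ = wi≡

  ⋀ : ∀ {m} → List (Formula S m) → Formula S m
  ⋀ []       = ¬ᶠ ⊥ᶠ
  ⋀ (φ ∷ φs) = φ ∧ᶠ ⋀ φs

  module _ {m} {w : Vector Carrier m} where

    Sat-⋀⁺ : ∀ {φs} → All.All (Sat S w) φs → Sat S w (⋀ φs)
    Sat-⋀⁺ []         = λ ()
    Sat-⋀⁺ (wφ ∷ wφs) = wφ , Sat-⋀⁺ wφs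

    Sat-⋀⁻ : ∀ φs → Sat S w (⋀ φs) → All.All (Sat S w) φs
    Sat-⋀⁻ []       _           = []
    Sat-⋀⁻ (φ ∷ φs) (wφ , wφs) = wφ ∷ Sat-⋀⁻ φs wφs

module Classes (em : ExcludedMiddle 0ℓ) {N : ℕ} (S : Structure N) (model : IsModelTN S) (n : ℕ) where
  open Structure S
  open IsModelTN model
  open Iterates S model
  open Classical em

  _⊆_ : Subset S n → Subset S n → Set
  X ⊆ Y = Defs._⊆_ S X Y

  Valid : Subset S n → Atom S n → Set
  Valid X α = ∀ x → X x → holds S x α

  Above : Subset S n → Fin n → Fin n → Set
  Above X i j = Σ ℕ λ m → ∀ x → X x → x i ≡ iter f m (x j)

  module _ {X : Subset S n} where

    above-refl : ∀ {i} → Above X i i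
    above-refl = 0 , λ _ _ → refl

    above-trans : ∀ {i j k} → Above X i j → Above X j k → Above X i k
    above-trans (a , xi≡) (b , xj≡) =
      a + b , λ x x∈X → trans (xi≡ x x∈X) (trans (cong (iter f a) (xj≡ x x∈X)) (sym (iter-+ a b _)))

    above⇒related : ∀ {i j} → Above X i j → Related S X i j
    above⇒related (m , xi≡) = m , inj₁ xi≡

    related-sym : ∀ {i j} → Related S X i j → Related S X j i
    related-sym (m , inj₁ xi≡) = m , inj₂ xi≡
    related-sym (m , inj₂ xj≡) = m , inj₁ xj≡

    related⇒above : ∀ {i j} → Related S X i j → Above X i j ⊎ Above X j i
    related⇒above (m , inj₁ xi≡) = inj₁ (m , xi≡)
    related⇒above (m , inj₂ xj≡) = inj₂ (m , xj≡)

    private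
      above-both⇒above : ∀ {i j k a b} → a ≤ b → (∀ x → X x → x i ≡ iter f a (x j)) →
                          (∀ x → X x → x k ≡ iter f b (x j)) → Above X k i
      above-both⇒above {a = a} a≤b xi≡ xk≡ = let d , split = iter-split a≤b in
        d , λ x x∈X → trans (xk≡ x x∈X)
          (trans (split _) (trans (iter-comm a d _) (cong (iter f d) (sym (xi≡ x x∈X)))))

      below-both⇒above : ∀ {i j k a b} → a ≤ b → (∀ x → X x → x j ≡ iter f a (x i)) →
                          (∀ x → X x → x j ≡ iter f b (x k)) → Above X i k
      below-both⇒above {a = a} a≤b xj≡ xj≡′ = let d , split = iter-split a≤b in
        d , λ x x∈X → iter-injective a (trans (sym (xj≡ x x∈X)) (trans (xj≡′ x x∈X) (split _)))

      above-both⇒related : ∀ {i j k} → Above X i j → Above X k j → Related S X i k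
      above-both⇒related (a , xi≡) (b , xk≡) with ℕ.≤-total a b
      ... | inj₁ a≤b = related-sym (above⇒related (above-both⇒above a≤b xi≡ xk≡))
      ... | inj₂ b≤a = above⇒related (above-both⇒above b≤a xk≡ xi≡)

      below-both⇒related : ∀ {i j k} → Above X j i → Above X j k → Related S X i k
      below-both⇒related (a , xj≡) (b , xj≡′) with ℕ.≤-total a b
      ... | inj₁ a≤b = above⇒related (below-both⇒above a≤b xj≡ xj≡′)
      ... | inj₂ b≤a = related-sym (above⇒related (below-both⇒above b≤a xj≡′ xj≡))

    related-trans : ∀ {i j k} → Related S X i j → Related S X j k → Related S X i k
    related-trans r r′ with related⇒above r | related⇒above r′
    ... | inj₁ i≥j | inj₁ j≥k = above⇒related (above-trans i≥j j≥k)
    ... | inj₂ j≥i | inj₂ k≥j = related-sym (above⇒related (above-trans k≥j j≥i))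
    ... | inj₁ i≥j | inj₂ k≥j = above-both⇒related i≥j k≥j
    ... | inj₂ j≥i | inj₁ j≥k = below-both⇒related j≥i j≥k

  module _ {X Y : Subset S n} (Y⊆X : Y ⊆ X) where

    above-antitone : ∀ {i j} → Above X i j → Above Y i j
    above-antitone (m , xi≡) = m , λ y y∈Y → xi≡ y (Y⊆X y y∈Y)

    related-antitone : ∀ {i j} → Related S X i j → Related S Y i j
    related-antitone (m , inj₁ xi≡) = m , inj₁ λ y y∈Y → xi≡ y (Y⊆X y y∈Y)
    related-antitone (m , inj₂ xj≡) = m , inj₂ λ y y∈Y → xj≡ y (Y⊆X y y∈Y)

    constant-antitone : ∀ {i} → ConstantOn S X i → ConstantOn S Y i
    constant-antitone (a , xi≡a) = a , λ y y∈Y → xi≡a y (Y⊆X y y∈Y)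

  Bottom : Subset S n → Fin n → Set
  Bottom X j = ¬ ConstantOn S X j × (∀ k → Related S X k j → Above X k j)

  Leader : Subset S n → Fin n → Set
  Leader X j = Bottom X j × (∀ {k} → k Fin.< j → Related S X k j → ¬ Above X j k)

  module _ {X : Subset S n} {z : Vector Carrier n} (z∈X : X z) where

    exponent-unique : ∀ {i j m m′} → (∀ x → X x → x i ≡ iter f m (x j)) →
                      z i ≡ iter f m′ (z j) → m ≡ m′
    exponent-unique {j = j} xi≡ zi≡ = iter-exponent-injective _ _ (z j) (trans (sym (xi≡ z z∈X)) zi≡)

    constant-transport : ∀ {i j} → Related S X i j → ConstantOn S X i → ConstantOn S X j
    constant-transport {i} {j} (m , inj₁ xi≡) (a , xi≡a) = z j , λ x x∈X →
      iter-injective m (trans (sym (xi≡ x x∈X))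
        (trans (xi≡a x x∈X) (trans (sym (xi≡a z z∈X)) (xi≡ z z∈X))))
    constant-transport (m , inj₂ xj≡) (a , xi≡a) =
      iter f m a , λ x x∈X → trans (xj≡ x x∈X) (cong (iter f m) (xi≡a x x∈X))

    private
      _⊏_ : Fin n → Fin n → Set
      k ⊏ j = Above X j k × ¬ Above X k j

      ⊏-wellFounded : WellFounded _⊏_
      ⊏-wellFounded = Subrelation.wellFounded shrinks (On.wellFounded (count ∘ Above X) ℕ.<-wellFounded)
        where
        shrinks : ∀ {k j} → k ⊏ j → count (Above X k) ℕ.< count (Above X j)
        shrinks {k} {j} (j≥k , k≱j) = count-strict (λ {l} → above-trans {k = l} j≥k) (above-refl {i = j}) k≱j

    bottom-exists : ∀ {i} → ¬ ConstantOn S X i → ∃ λ b → Bottom X b × Related S X i b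
    bottom-exists {i} ¬const with minimal ⊏-wellFounded (Above X i) (above-refl {i = i})
    ... | b , i≥b , b-minimal = b , (¬const ∘ constant-transport (related-sym i~b) , below) , i~b
      where
      i~b = above⇒related i≥b
      below : ∀ k → Related S X k b → Above X k b
      below k r with related⇒above r
      ... | inj₁ k≥b = k≥b
      ... | inj₂ b≥k = double-negation λ k≱b → b-minimal (b≥k , k≱b) (above-trans i≥b b≥k)

    leader-exists : ∀ {i} → ¬ ConstantOn S X i → ∃ λ j → Leader X j × Related S X i j
    leader-exists {i} ¬const with bottom-exists ¬const
    ... | b , b-bottom , i~b with minimal Fin.<-wellFounded (λ k → Bottom X k × Related S X i k) (b-bottom , i~b)
    ... | j , (j-bottom , i~j) , j-least = j , (j-bottom , j-minimal) , i~j
      where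
      j-minimal : ∀ {k} → k Fin.< j → Related S X k j → ¬ Above X j k
      j-minimal k<j k~j j≥k = j-least k<j (k-bottom , related-trans i~j (related-sym k~j))
        where
        k-bottom : Bottom _ _
        k-bottom = proj₁ j-bottom ∘ constant-transport k~j
                 , λ l l~k → above-trans (proj₂ j-bottom l (related-trans l~k k~j)) j≥k

  leader-unique : ∀ {X i j} → Leader X i → Leader X j → Related S X i j → i ≡ j
  leader-unique {X} {i} {j} (i-bottom , i-minimal) (j-bottom , j-minimal) i~j with Fin.<-cmp i j
  ... | tri< i<j _ _ = contradiction (proj₂ i-bottom j (related-sym i~j)) (j-minimal i<j i~j)
  ... | tri≈ _ i≡j _ = i≡j
  ... | tri> _ _ j<i = contradiction (proj₂ j-bottom i i~j) (i-minimal j<i (related-sym i~j))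

  module _ {X Y : Subset S n} (Y⊆X : Y ⊆ X) {z : Vector Carrier n} (z∈Y : Y z) where

    related-exponent : ∀ {i j m} → (∀ y → Y y → y i ≡ iter f m (y j)) →
                       Related S X i j → ∀ x → X x → x i ≡ iter f m (x j)
    related-exponent {i} {j} {m} yi≡ (m′ , inj₁ xi≡) =
      subst (λ e → ∀ x → X x → x i ≡ iter f e (x j)) m′≡m xi≡
      where
      m′≡m = exponent-unique {X = X} (Y⊆X z z∈Y) {m = m′} {m′ = m} xi≡ (yi≡ z z∈Y)
    related-exponent {i} {j} {m} yi≡ (m′ , inj₂ xj≡) x x∈X =
      subst (λ e → x i ≡ iter f e (x j)) (sym m≡0)
        (sym (subst (λ e → x j ≡ iter f e (x i)) m′≡0 (xj≡ x x∈X)))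
      where
      m+m′≡0 : m + m′ ≡ 0
      m+m′≡0 = iter-round-trip {a = m} {b = m′} (yi≡ z z∈Y) (xj≡ z (Y⊆X z z∈Y))
      m≡0  = ℕ.m+n≡0⇒m≡0 m m+m′≡0
      m′≡0 = ℕ.m+n≡0⇒n≡0 m m+m′≡0

    bottom-mono : ∀ {j} → Bottom Y j → Bottom X j
    bottom-mono (¬const , below) = ¬const ∘ constant-antitone Y⊆X , λ k k~j →
      let m , yk≡ = below k (related-antitone Y⊆X k~j) in m , related-exponent {m = m} yk≡ k~j

    leader-mono : ∀ {j} → Leader Y j → Leader X j
    leader-mono (j-bottom , j-minimal) =
      bottom-mono j-bottom , λ k<j k~j j≥k → j-minimal k<j (related-antitone Y⊆X k~j) (above-antitone Y⊆X j≥k)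

  classCount : Subset S n → ℕ
  classCount X = count (Leader X)

  leaders : (X : Subset S n) → Fin (classCount X) → Fin n
  leaders X = Enumeration.enum (enumeration (Leader X))

  numClasses : ∀ {X z} → X z → NumClasses S X (classCount X)
  numClasses {X} z∈X = leaders X , (λ p → proj₁ (proj₁ (sound p))) , distinct , covering
    where
    open Enumeration (enumeration (Leader X))
    distinct : ∀ p q → Related S X (enum p) (enum q) → p ≡ q
    distinct p q r = injective (leader-unique (sound p) (sound q) r)
    covering : ∀ i → ¬ ConstantOn S X i → ∃ λ p → Related S X i (enum p)
    covering i ¬const with leader-exists z∈X ¬const
    ... | j , j-leader , i~j with complete j-leader
    ... | p , refl = p , i~j

  Closure : Subset S n → Subset S n
  Closure X x = ∀ α → Valid X α → holds S x α

  ⋂-simple-closed : ∀ {X} (I : Set) (F : I → List (Atom S n)) →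
                    (∀ x → (X x → ∀ i → ⟦_⟧ˢ S (F i) x) × ((∀ i → ⟦_⟧ˢ S (F i) x) → X x)) → IsClosed S X
  ⋂-simple-closed I F X≡ = I , (λ i → F i ∷ []) , λ x →
    (λ x∈X i → here (proj₁ (X≡ x) x∈X i)) , λ x∈ → proj₂ (X≡ x) λ i → Anyₚ.singleton⁻ (x∈ i)

  private
    simple-closed : (as : List (Atom S n)) → IsClosed S (⟦_⟧ˢ S as)
    simple-closed as = ⋂-simple-closed ⊤ (λ _ → as) λ x → (λ x∈ _ → x∈) , λ x∈ → x∈ tt

    union-closed : (bss : List (List (Atom S n))) → IsClosed S (⟦_⟧ᵇ S bss)
    union-closed bss = ⊤ , (λ _ → bss) , λ x → (λ x∈ _ → x∈) , λ x∈ → x∈ tt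

    irreducible-in-union : ∀ {Z} → IsIrreducible S Z → (bss : List (List (Atom S n))) →
                           Z ⊆ ⟦_⟧ᵇ S bss → Any (λ as → Z ⊆ ⟦_⟧ˢ S as) bss
    irreducible-in-union (_ , (z , z∈Z) , _) [] Z⊆ with Z⊆ z z∈Z
    ... | ()
    irreducible-in-union Z-irr@(_ , _ , split) (as ∷ bss) Z⊆
      with split (⟦_⟧ˢ S as) (⟦_⟧ᵇ S bss) (simple-closed as) (union-closed bss)
                 (λ x → Any.toSum ∘ Z⊆ x)
    ... | inj₁ Z⊆as  = here Z⊆as
    ... | inj₂ Z⊆bss = there (irreducible-in-union Z-irr bss Z⊆bss)


  closure-⊆-simple : ∀ {Z} {as : List (Atom S n)} → Z ⊆ ⟦_⟧ˢ S as → Closure Z ⊆ ⟦_⟧ˢ S as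
  closure-⊆-simple Z⊆ x x∈cl = All.tabulate λ α∈as → x∈cl _ λ y y∈Z → All.lookup (Z⊆ y y∈Z) α∈as

  irreducible⇒closure⊆ : ∀ {Z} → IsIrreducible S Z → Closure Z ⊆ Z
  irreducible⇒closure⊆ Z-irr@((_ , F , Z≡) , _) x x∈cl = proj₂ (Z≡ x) λ i →
    Any.map (λ Z⊆ → closure-⊆-simple Z⊆ x x∈cl)
      (irreducible-in-union Z-irr (F i) λ y y∈Z → proj₁ (Z≡ y) y∈Z i)

  module _ {Z Z′ : Subset S n} (Z⊆Z′ : Z ⊆ Z′) {z : Vector Carrier n} (z∈Z : Z z)
           (same-leaders : ∀ {i} → Leader Z′ i → Leader Z i) where

    private
      z∈Z′ = Z⊆Z′ z z∈Z

      constant-ascends : ∀ {i} → ConstantOn S Z i → ConstantOn S Z′ i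
      constant-ascends {i} const = double-negation λ ¬const′ →
        let j , j-leader , i~j = leader-exists z∈Z′ ¬const′
        in proj₁ (proj₁ (same-leaders j-leader)) (constant-transport z∈Z (related-antitone Z⊆Z′ i~j) const)

      related-ascends : ∀ {i j} → ¬ ConstantOn S Z′ i → ¬ ConstantOn S Z′ j →
                        Related S Z i j → Related S Z′ i j
      related-ascends ¬const-i ¬const-j i~j with leader-exists z∈Z′ ¬const-i | leader-exists z∈Z′ ¬const-j
      ... | l , l-leader , i~l | l′ , l′-leader , j~l′ =
        related-trans i~l (subst (λ k → Related S Z′ k _) (sym l≡l′) (related-sym j~l′))
        where
        l≡l′ : l ≡ l′
        l≡l′ = leader-unique (same-leaders l-leader) (same-leaders l′-leader)
          (related-trans (related-sym (related-antitone Z⊆Z′ i~l))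
            (related-trans i~j (related-antitone Z⊆Z′ j~l′)))

    valid-ascends : ∀ α → Valid Z α → Valid Z′ α
    valid-ascends (eqc i a) zi≡ x x∈Z′ =
      let b , xi≡b = constant-ascends (a , zi≡)
      in trans (xi≡b x x∈Z′) (trans (sym (xi≡b z z∈Z′)) (zi≡ z z∈Z))
    valid-ascends (eqf i j m) xi≡ with em {ConstantOn S Z i}
    ... | yes const-i = λ x x∈Z′ → begin
        x i                ≡⟨ trans (xi≡a x x∈Z′) (sym (xi≡a z z∈Z′)) ⟩
        z i                ≡⟨ xi≡ z z∈Z ⟩
        iter f m (z j)     ≡⟨ cong (iter f m) (trans (xj≡b z z∈Z′) (sym (xj≡b x x∈Z′))) ⟩
        iter f m (x j)     ∎
      where
      open ≡-Reasoning
      xi≡a = proj₂ (constant-ascends const-i)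
      xj≡b = proj₂ (constant-ascends (constant-transport z∈Z (above⇒related (m , xi≡)) const-i))
    ... | no ¬const-i = related-exponent Z⊆Z′ z∈Z {m = m} xi≡ (related-ascends ¬const-i′ ¬const-j′ i~j)
      where
      i~j = above⇒related (m , xi≡)
      ¬const-i′ = ¬const-i ∘ constant-antitone Z⊆Z′
      ¬const-j′ = ¬const-i ∘ constant-transport z∈Z (related-sym i~j) ∘ constant-antitone Z⊆Z′

  classCount-strict : ∀ {Z Z′} → IsIrreducible S Z → _⊊_ S Z Z′ → classCount Z ℕ.< classCount Z′
  classCount-strict {Z} {Z′} Z-irr@(_ , (z , z∈Z) , _) (Z⊆Z′ , Z′⊈Z)
    with em {∃ λ i → Leader Z′ i × ¬ Leader Z i}
  ... | yes (i , leader′ , ¬leader) = count-strict {P = Leader Z} (leader-mono Z⊆Z′ z∈Z) leader′ ¬leader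
  ... | no ∄i = contradiction Z′⊆Z Z′⊈Z
    where
    same-leaders : ∀ {i} → Leader Z′ i → Leader Z i
    same-leaders leader′ = double-negation λ ¬leader → ∄i (_ , leader′ , ¬leader)
    Z′⊆Z : Z′ ⊆ Z
    Z′⊆Z x x∈Z′ = irreducible⇒closure⊆ Z-irr x λ α valid → valid-ascends Z⊆Z′ z∈Z same-leaders α valid x x∈Z′

  chain-length≤classCount : ∀ {X m} → HasChain S X m → m ≤ classCount X
  chain-length≤classCount {X} {m} (Z , Z-irr , Z-strict , top⊆X) = ℕ.≤-trans
    (increasing⇒length≤last m (classCount ∘ Z) λ i → classCount-strict (Z-irr _) (Z-strict i))
    (count-mono {Q = Leader X} (leader-mono top⊆X (proj₂ (proj₁ (proj₂ (Z-irr (fromℕ m)))))))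

  module _ {Z : Subset S n} (Z-closed : IsClosed S Z) (g : ℕ → Vector Carrier n) (g∈Z : ∀ K → Z (g K))
           (g-generic : ∀ α → ¬ Valid Z α → Eventually λ K → ¬ holds S (g K) α) where

    private
      avoids-invalid : ∀ {as} → Any (¬_ ∘ Valid Z) as → Eventually λ K → ¬ ⟦_⟧ˢ S as (g K)
      avoids-invalid (here ¬valid)  = eventually-map (λ ¬holds → ¬holds ∘ All.head) (g-generic _ ¬valid)
      avoids-invalid (there invalid) = eventually-map (λ ¬holds → ¬holds ∘ All.tail) (avoids-invalid invalid)

      avoids-simple : ∀ as → ¬ Z ⊆ ⟦_⟧ˢ S as → Eventually λ K → ¬ ⟦_⟧ˢ S as (g K)
      avoids-simple as Z⊈as with em {All.All (Valid Z) as}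
      ... | yes valid  = contradiction (λ x x∈Z → All.map (λ v → v x x∈Z) valid) Z⊈as
      ... | no ¬valid = avoids-invalid (¬All⇒Any¬ (λ _ → em) as ¬valid)

      avoids-union : ∀ bss → ¬ Z ⊆ ⟦_⟧ᵇ S bss → Eventually λ K → ¬ ⟦_⟧ᵇ S bss (g K)
      avoids-union []          _       = 0 , λ _ _ ()
      avoids-union (as ∷ bss) Z⊈bss =
        eventually-map (λ (¬as , ¬bss) → [ ¬as , ¬bss ] ∘ Any.toSum)
          (eventually-× (avoids-simple as λ Z⊆as → Z⊈bss λ x → here ∘ Z⊆as x)
                        (avoids-union bss λ Z⊆bss → Z⊈bss λ x → there ∘ Z⊆bss x))

      avoids-closed : ∀ {Y} → IsClosed S Y → ¬ Z ⊆ Y → Eventually λ K → ¬ Y (g K)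
      avoids-closed {Y} (_ , F , Y≡) Z⊈Y with em {∃ λ i → ¬ Z ⊆ ⟦_⟧ᵇ S (F i)}
      ... | yes (i , Z⊈Fi) = eventually-map (λ ¬Fi y∈Y → ¬Fi (proj₁ (Y≡ _) y∈Y i)) (avoids-union (F i) Z⊈Fi)
      ... | no ∄i = contradiction Z⊆Y Z⊈Y
        where
        Z⊆Y : Z ⊆ Y
        Z⊆Y x x∈Z = proj₂ (Y≡ x) λ i → double-negation λ x∉Fi → ∄i (i , λ Z⊆Fi → x∉Fi (Z⊆Fi x x∈Z))

    generic⇒irreducible : IsIrreducible S Z
    generic⇒irreducible = Z-closed , (g 0 , g∈Z 0) , split
      where
      split : ∀ Y W → IsClosed S Y → IsClosed S W → Z ⊆ (λ x → Y x ⊎ W x) → Z ⊆ Y ⊎ Z ⊆ W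
      split Y W Y-closed W-closed Z⊆Y∪W with em {Z ⊆ Y} | em {Z ⊆ W}
      ... | yes Z⊆Y | _       = inj₁ Z⊆Y
      ... | no _    | yes Z⊆W = inj₂ Z⊆W
      ... | no Z⊈Y  | no Z⊈W  with eventually-× (avoids-closed Y-closed Z⊈Y) (avoids-closed W-closed Z⊈W)
      ...   | N , avoids =
        ⊥-elim ([ proj₁ (avoids N ℕ.≤-refl) , proj₂ (avoids N ℕ.≤-refl) ] (Z⊆Y∪W (g N) (g∈Z N)))

module Parametrization (em : ExcludedMiddle 0ℓ) {N : ℕ} (S : Structure N) (model : IsModelTN S)
  {n : ℕ} (A : Subset S n) (as : List (Atom S n))
  (A≡as : ∀ x → (A x → ⟦_⟧ˢ S as x) × (⟦_⟧ˢ S as x → A x))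
  {z : Vector (Structure.Carrier S) n} (z∈A : A z) where

  open Structure S
  open IsModelTN model
  open Iterates S model
  open Classical em
  open Classes em S model n

  private
    module L = Enumeration (enumeration (Leader A))

  k : ℕ
  k = classCount A

  r : Fin k → Fin n
  r = leaders A

  r-nonconstant : ∀ p → ¬ ConstantOn S A (r p)
  r-nonconstant p = proj₁ (proj₁ (L.sound p))

  r-unrelated : ∀ {p q} → Related S A (r p) (r q) → p ≡ q
  r-unrelated rp~rq = L.injective (leader-unique (L.sound _) (L.sound _) rp~rq)

  data CoordinateForm (i : Fin n) : Set where
    constant : (a : Carrier) → (∀ x → A x → x i ≡ a) → CoordinateForm i
    orbit    : (p : Fin k) (m : ℕ) → ¬ ConstantOn S A i → (∀ x → A x → x i ≡ iter f m (x (r p))) →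
               CoordinateForm i

  coordinateForm : ∀ i → CoordinateForm i
  coordinateForm i with em {ConstantOn S A i}
  ... | yes (a , xi≡a) = constant a xi≡a
  ... | no ¬const with leader-exists z∈A ¬const
  ... | j , j-leader , i~j with L.complete j-leader
  ... | p , refl = let m , xi≡ = proj₂ (proj₁ j-leader) i i~j in orbit p m ¬const xi≡

  evaluate : ∀ {i} → CoordinateForm i → Vector Carrier k → Carrier
  evaluate (constant a _)   y = a
  evaluate (orbit p m _ _) y = iter f m (y p)

  param : Vector Carrier k → Vector Carrier n
  param y i = evaluate (coordinateForm i) y

  param-leader : ∀ y p → param y (r p) ≡ y p
  param-leader y p = evaluate-leader (coordinateForm (r p))
    where
    evaluate-leader : (cf : CoordinateForm (r p)) → evaluate cf y ≡ y p
    evaluate-leader (constant a xrp≡a) = contradiction (a , xrp≡a) (r-nonconstant p)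
    evaluate-leader (orbit q m _ xrp≡) with r-unrelated (above⇒related (m , xrp≡))
    ... | refl with exponent-unique z∈A {m = m} {m′ = 0} xrp≡ refl
    ... | refl = refl

  param-coordinates : ∀ x → A x → ∀ i → x i ≡ param (x ∘ r) i
  param-coordinates x x∈A i = coordinate (coordinateForm i)
    where
    coordinate : (cf : CoordinateForm i) → x i ≡ evaluate cf (x ∘ r)
    coordinate (constant a xi≡a) = xi≡a x x∈A
    coordinate (orbit p m _ xi≡) = xi≡ x x∈A

  param-valid : ∀ α → Valid A α → ∀ y → holds S (param y) α
  param-valid (eqc i a) xi≡a y = valid (coordinateForm i)
    where
    valid : (cf : CoordinateForm i) → evaluate cf y ≡ a
    valid (constant b xi≡b)     = trans (sym (xi≡b z z∈A)) (xi≡a z z∈A)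
    valid (orbit _ _ ¬const _) = contradiction (a , xi≡a) ¬const
  param-valid (eqf i j m) xi≡ y = valid (coordinateForm i) (coordinateForm j)
    where
    i~j = above⇒related (m , xi≡)
    valid : (cf : CoordinateForm i) (cf′ : CoordinateForm j) → evaluate cf y ≡ iter f m (evaluate cf′ y)
    valid (constant a xi≡a) (constant b xj≡b) =
      trans (sym (xi≡a z z∈A)) (trans (xi≡ z z∈A) (cong (iter f m) (xj≡b z z∈A)))
    valid (constant a xi≡a) (orbit _ _ ¬const _) =
      contradiction (constant-transport z∈A i~j (a , xi≡a)) ¬const
    valid (orbit _ _ ¬const _) (constant b xj≡b) =
      contradiction (constant-transport z∈A (related-sym i~j) (b , xj≡b)) ¬const
    valid (orbit p u _ xi≡u) (orbit q w _ xj≡w)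
      with r-unrelated (related-trans (related-sym (above⇒related (u , xi≡u)))
                         (related-trans i~j (above⇒related (w , xj≡w))))
    ... | refl = trans (cong (λ e → iter f e (y p)) u≡m+w) (iter-+ m w (y p))
      where
      u≡m+w : u ≡ m + w
      u≡m+w = exponent-unique z∈A {m = u} {m′ = m + w} xi≡u
        (trans (xi≡ z z∈A) (trans (cong (iter f m) (xj≡w z z∈A)) (sym (iter-+ m w _))))

  param∈A : ∀ y → A (param y)
  param∈A y = proj₂ (A≡as (param y))
    (closure-⊆-simple (λ x → proj₁ (A≡as x)) (param y) λ α valid → param-valid α valid y)

  module Stratum (c₀ : Carrier) (t : Fin (suc k)) where

    Fixed : Fin k → Set
    Fixed p = toℕ t ≤ toℕ p

    Z : Subset S n
    Z x = A x × (∀ p → Fixed p → x (r p) ≡ c₀)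

    Z-closed : IsClosed S Z
    Z-closed = ⋂-simple-closed (⊤ ⊎ Σ (Fin k) Fixed) F λ x → to x , from x
      where
      F : ⊤ ⊎ Σ (Fin k) Fixed → List (Atom S n)
      F (inj₁ _)       = as
      F (inj₂ (p , _)) = eqc (r p) c₀ ∷ []
      to : ∀ x → Z x → ∀ i → ⟦_⟧ˢ S (F i) x
      to x (x∈A , _)    (inj₁ _)             = proj₁ (A≡as x) x∈A
      to x (_ , x-fixed) (inj₂ (p , p-fixed)) = x-fixed p p-fixed ∷ []
      from : ∀ x → (∀ i → ⟦_⟧ˢ S (F i) x) → Z x
      from x x∈F = proj₂ (A≡as x) (x∈F (inj₁ tt)) , λ p p-fixed → All.head (x∈F (inj₂ (p , p-fixed)))

    slope : Fin k → ℕ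
    slope p = suc (toℕ p)

    generic : ℕ → Vector Carrier k
    generic K p with toℕ t ℕ.≤? toℕ p
    ... | yes _ = c₀
    ... | no _  = iter f (slope p * K) c₀

    generic-fixed : ∀ {K p} → Fixed p → generic K p ≡ c₀
    generic-fixed {K} {p} p-fixed with toℕ t ℕ.≤? toℕ p
    ... | yes _       = refl
    ... | no p-free = contradiction p-fixed p-free

    generic-free : ∀ {K p} → ¬ Fixed p → generic K p ≡ iter f (slope p * K) c₀
    generic-free {K} {p} p-free with toℕ t ℕ.≤? toℕ p
    ... | yes p-fixed = contradiction p-fixed p-free
    ... | no _        = refl

    g : ℕ → Vector Carrier n
    g K = param (generic K)

    g∈Z : ∀ K → Z (g K)
    g∈Z K = param∈A _ , λ p p-fixed → trans (param-leader _ p) (generic-fixed p-fixed)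

    data GenericForm (i : Fin n) (value : ℕ → Carrier) : Set where
      fixed  : (b : Carrier) → (∀ x → Z x → x i ≡ b) → (∀ K → value K ≡ b) → GenericForm i value
      moving : (p : Fin k) (u : ℕ) → (∀ x → Z x → x i ≡ iter f u (x (r p))) →
               (∀ K → value K ≡ iter f u (iter f (slope p * K) c₀)) → GenericForm i value

    genericForm : ∀ i → GenericForm i (λ K → g K i)
    genericForm i = classify (coordinateForm i)
      where
      classify : (cf : CoordinateForm i) → GenericForm i (λ K → evaluate cf (generic K))
      classify (constant a xi≡a) = fixed a (λ x → xi≡a x ∘ proj₁) λ _ → refl
      classify (orbit p m _ xi≡) with toℕ t ℕ.≤? toℕ p
      ... | yes p-fixed = fixed (iter f m c₀)
        (λ x (x∈A , x-fixed) → trans (xi≡ x x∈A) (cong (iter f m) (x-fixed p p-fixed)))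
        λ _ → refl
      ... | no p-free = moving p m (λ x → xi≡ x ∘ proj₁) λ _ → refl

    g-generic : ∀ α → ¬ Valid Z α → Eventually λ K → ¬ holds S (g K) α
    g-generic (eqc i a) invalid = avoid (genericForm i)
      where
      avoid : ∀ {v} → GenericForm i v → Eventually λ K → ¬ v K ≡ a
      avoid (fixed b xi≡b v≡b) =
        0 , λ K _ vK≡a → invalid λ x x∈Z → trans (xi≡b x x∈Z) (trans (sym (v≡b K)) vK≡a)
      avoid (moving p u _ v≡) = at-most-once⇒eventually-not λ vK≡a vK′≡a →
        orbits-meet-once {s = slope p} {s′ = 0} u 0 c₀ a (λ ())
          (trans (sym (v≡ _)) vK≡a) (trans (sym (v≡ _)) vK′≡a)
    g-generic (eqf i j m) invalid = avoid (genericForm i) (genericForm j)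
      where
      avoid : ∀ {v v′} → GenericForm i v → GenericForm j v′ → Eventually λ K → ¬ v K ≡ iter f m (v′ K)
      avoid (fixed b xi≡b v≡b) (fixed b′ xj≡b′ v′≡b′) = 0 , λ K _ eq → invalid λ x x∈Z →
        trans (xi≡b x x∈Z)
          (trans (sym (v≡b K)) (trans eq (cong (iter f m) (trans (v′≡b′ K) (sym (xj≡b′ x x∈Z))))))
      avoid {v} {v′} (fixed b _ v≡b) (moving q w _ v′≡) = at-most-once⇒eventually-not λ eq eq′ →
        orbits-meet-once {s = 0} {s′ = slope q} 0 (m + w) b c₀ (λ ()) (unfold eq) (unfold eq′)
        where
        unfold : ∀ {K} → v K ≡ iter f m (v′ K) → b ≡ iter f (m + w) (iter f (slope q * K) c₀)
        unfold {K} eq = trans (sym (v≡b K)) (trans eq (trans (cong (iter f m) (v′≡ K)) (sym (iter-+ m w _))))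
      avoid {v} {v′} (moving p u _ v≡) (fixed b _ v′≡b) = at-most-once⇒eventually-not λ eq eq′ →
        orbits-meet-once {s = slope p} {s′ = 0} u m c₀ b (λ ()) (unfold eq) (unfold eq′)
        where
        unfold : ∀ {K} → v K ≡ iter f m (v′ K) → iter f u (iter f (slope p * K) c₀) ≡ iter f m b
        unfold {K} eq = trans (sym (v≡ K)) (trans eq (cong (iter f m) (v′≡b K)))
      avoid {v} {v′} (moving p u xi≡ v≡) (moving q w xj≡ v′≡) with p Fin.≟ q
      ... | yes refl = 0 , λ K _ eq → invalid (valid (iter-exponent-injective u (m + w) _ (unfold eq)))
        where
        unfold : ∀ {K} → v K ≡ iter f m (v′ K) →
                 iter f u (iter f (slope p * K) c₀) ≡ iter f (m + w) (iter f (slope p * K) c₀)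
        unfold {K} eq = trans (sym (v≡ K)) (trans eq (trans (cong (iter f m) (v′≡ K)) (sym (iter-+ m w _))))
        valid : u ≡ m + w → Valid Z (eqf i j m)
        valid refl x x∈Z = trans (xi≡ x x∈Z) (trans (iter-+ m w _) (cong (iter f m) (sym (xj≡ x x∈Z))))
      ... | no p≢q = at-most-once⇒eventually-not λ eq eq′ →
        orbits-meet-once {s = slope p} {s′ = slope q} u (m + w) c₀ c₀
          (p≢q ∘ Fin.toℕ-injective ∘ ℕ.suc-injective) (unfold eq) (unfold eq′)
        where
        unfold : ∀ {K} → v K ≡ iter f m (v′ K) →
                 iter f u (iter f (slope p * K) c₀) ≡ iter f (m + w) (iter f (slope q * K) c₀)
        unfold {K} eq = trans (sym (v≡ K)) (trans eq (trans (cong (iter f m) (v′≡ K)) (sym (iter-+ m w _))))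

    Z-irreducible : IsIrreducible S Z
    Z-irreducible = generic⇒irreducible Z-closed g g∈Z g-generic

  strata-chain : Carrier → HasChain S A k
  strata-chain c₀ = Z , (λ t → Z-irreducible t) , strict , λ _ → proj₁
    where
    open Stratum c₀
    strict : ∀ i → _⊊_ S (Z (inject₁ i)) (Z (fsuc i))
    strict i = (λ x (x∈A , x-fixed) → x∈A , λ p → x-fixed p ∘ fixed-earlier) , λ Z⊆ →
      acyclic c₀ (toℕ i * 1) (begin
        iter f (slope (fsuc i) i * 1) c₀  ≡⟨ generic-free (fsuc i) (ℕ.n≮n (toℕ i)) ⟨
        generic (fsuc i) 1 i              ≡⟨ param-leader _ i ⟨
        g (fsuc i) 1 (r i)                ≡⟨ proj₂ (Z⊆ _ (g∈Z (fsuc i) 1)) i (ℕ.≤-reflexive (Fin.toℕ-inject₁ i)) ⟩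
        c₀                                ∎)
      where
      open ≡-Reasoning
      fixed-earlier : ∀ {p} → Fixed (fsuc i) p → Fixed (inject₁ i) p
      fixed-earlier i<p = subst (_≤ _) (sym (Fin.toℕ-inject₁ i)) (ℕ.<⇒≤ i<p)

  param-cong : ∀ {y y′} → y ≗ y′ → param y ≗ param y′
  param-cong {y} {y′} y≈y′ i = evaluate-cong (coordinateForm i)
    where
    evaluate-cong : (cf : CoordinateForm i) → evaluate cf y ≡ evaluate cf y′
    evaluate-cong (constant a _)   = refl
    evaluate-cong (orbit p m _ _) = cong (iter f m) (y≈y′ p)

  A-resp-≈ : ∀ {x x′} → x ≗ x′ → A x → A x′
  A-resp-≈ {x} {x′} x≈x′ x∈A = proj₂ (A≡as x′) (All.map holds-resp (proj₁ (A≡as x) x∈A))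
    where
    holds-resp : ∀ {α} → holds S x α → holds S x′ α
    holds-resp {eqf i j m} xi≡ = trans (sym (x≈x′ i)) (trans xi≡ (cong (iter f m) (x≈x′ j)))
    holds-resp {eqc i a}   xi≡ = trans (sym (x≈x′ i)) xi≡

  graph : Subset S (n + k)
  graph w = A (λ i → w (i ↑ˡ k)) × (∀ p → w (n ↑ʳ p) ≡ w (r p ↑ˡ k))

  graph-definable : Definable S graph
  graph-definable = φ , λ w → (λ (w∈A , w-right) →
      Sat-⋀⁺ (Allₚ.map⁺ (All.map (Sat-atom⁺ _) (proj₁ (A≡as _) w∈A))) , Sat-⋀⁺ (Allₚ.tabulate⁺ w-right))
    , λ (w⊨A , w⊨right) →
      proj₂ (A≡as _) (All.map (Sat-atom⁻ _) (Allₚ.map⁻ (Sat-⋀⁻ _ w⊨A))) , Allₚ.tabulate⁻ (Sat-⋀⁻ _ w⊨right)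
    where
    open Formulas S
    φ : Formula S (n + k)
    φ = ⋀ (List.map (atomFormula (_↑ˡ k)) as) ∧ᶠ ⋀ (List.tabulate λ p → var (n ↑ʳ p) ≐ var (r p ↑ˡ k))

  param-bijection : DefinableBijection S A k
  param-bijection = graph , graph-definable , graph⊆A , forward , backward
    where
    left≈ : ∀ x y → (λ i → (x ++ y) (i ↑ˡ k)) ≗ x
    left≈ x y = lookup-++ˡ x y

    graph⊆A : ∀ x y → graph (x ++ y) → A x
    graph⊆A x y (xy∈A , _) = A-resp-≈ (left≈ x y) xy∈A

    leaders-of : ∀ {x y} → graph (x ++ y) → ∀ p → y p ≡ x (r p)
    leaders-of {x} {y} (_ , xy-right) p = begin
      y p                  ≡⟨ lookup-++ʳ x y p ⟨
      (x ++ y) (n ↑ʳ p)    ≡⟨ xy-right p ⟩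
      (x ++ y) (r p ↑ˡ k)  ≡⟨ lookup-++ˡ x y (r p) ⟩
      x (r p)              ∎
      where open ≡-Reasoning

    into-graph : ∀ {x y} → A x → (∀ p → y p ≡ x (r p)) → graph (x ++ y)
    into-graph {x} {y} x∈A y≡ = A-resp-≈ (λ i → sym (left≈ x y i)) x∈A , λ p →
      trans (lookup-++ʳ x y p) (trans (y≡ p) (sym (lookup-++ˡ x y (r p))))

    forward : ∀ x → A x → ∃ λ y → graph (x ++ y) × (∀ y′ → graph (x ++ y′) → y′ ≗ y)
    forward x x∈A = x ∘ r , into-graph x∈A (λ _ → refl) , λ y′ → leaders-of

    backward : ∀ y → ∃ λ x → A x × graph (x ++ y) × (∀ x′ → A x′ → graph (x′ ++ y) → x′ ≗ x)
    backward y = param y , param∈A y , into-graph (param∈A y) (λ p → sym (param-leader y p))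
      , λ x′ x′∈A x′y∈graph i →
          trans (param-coordinates x′ x′∈A i) (param-cong (λ p → sym (leaders-of x′y∈graph p)) i)

lemma4p15 : ExcludedMiddle 0ℓ → ExcludedMiddle (Level.suc 0ℓ) →
    (N : ℕ) → N ≥ 1 → (S : Structure N) → IsModelTN S →
    (n : ℕ) → n ≥ 1 → (A : Subset S n) → IsSimple S A → Infinite S A →
    (d : ℕ) → HasDimension S A d →
    DefinableBijection S A d × NumClasses S A d
lemma4p15 em _ (suc _) _ S model n _ A (as , A≡as) _ d (chain@(Z , Z-irr , _ , top⊆A) , maximal) =
  subst (λ e → DefinableBijection S A e × NumClasses S A e) (sym d≡k) (param-bijection , numClasses z∈A)
  where
  open Classes em S model n
  z∈top = proj₂ (proj₁ (proj₂ (Z-irr (fromℕ d))))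
  z∈A = top⊆A _ z∈top
  open Parametrization em S model A as A≡as z∈A
  d≡k : d ≡ classCount A
  d≡k = ℕ.≤-antisym (chain-length≤classCount chain) (maximal k (strata-chain (Structure.c S fzero)))
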